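{- Let $n\ge1$. The map $\phi:\mathcal{C}(G_n)\times H_n\to\mathcal{C}(G_n)$ defined by $\phi(P,M)=\overline{\overline{P}M}$ is a well-defined right group action of $H_n$ on $\mathcal{C}(G_n)$.
   Context: Let $Q_n=\{1,\dots,n\}$. A preference matrix on $Q_n$ is a $2^n\times n$ $0/1$ matrix whose rows are exactly the $2^n$ elements of $\{0,1\}^n$, each once. $\mathcal{C}(G_n)$ is the set of preference matrices on $Q_n$ in which consecutive rows differ in exactly one coordinate. $H_n$ is the hyperoctahedral group, realized as the subgroup of $GL_n(\mathbb{Z})$ of $n\times n$ matrices with entries in $\{0,\pm1\}$ having exactly one nonzero entry in each row and each column. For a matrix $P$ with entries in $\{0,1,-1\}$, $\overline{P}$ denotes the matrix obtained by replacing each $0$ by $-1$ and each $-1$ by $0$. -}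

module Defs where

open import Data.Nat using (ℕ; zero; suc; _<_; _^_)
open import Data.Nat.Properties using (<-trans; n<1+n)
open import Data.Integer using (ℤ; +_; -[1+_]; _+_; _*_; -_)
open import Data.Fin using (Fin; fromℕ<)
import Data.Fin as F
open import Data.Product using (Σ; ∃; _×_)
open import Data.Sum using (_⊎_)
open import Relation.Binary.PropositionalEquality using (_≡_; _≢_)
open import Relation.Nullary using (yes; no)

Mat : ℕ → ℕ → Set
Mat m k = Fin m → Fin k → ℤ

_≈ₘ_ : ∀ {m k} → Mat m k → Mat m k → Set
A ≈ₘ B = ∀ i j → A i j ≡ B i j

sumFin : (n : ℕ) → (Fin n → ℤ) → ℤ
sumFin zero f = + 0
sumFin (suc n) f = f F.zero + sumFin n (λ j → f (F.suc j))

_*ₘ_ : ∀ {m k l} → Mat m k → Mat k l → Mat m l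
_*ₘ_ {k = k} A B i l = sumFin k (λ j → A i j * B j l)

idM : (n : ℕ) → Mat n n
idM n i j with i F.≟ j
... | yes _ = + 1
... | no _ = + 0

barℤ : ℤ → ℤ
barℤ (+ 0) = -[1+ 0 ]
barℤ -[1+ 0 ] = + 0
barℤ x = x

bar : ∀ {m k} → Mat m k → Mat m k
bar P i j = barℤ (P i j)

Bit : ℤ → Set
Bit x = (x ≡ + 0) ⊎ (x ≡ + 1)

IsPreference : (n : ℕ) → Mat (2 ^ n) n → Set
IsPreference n P =
  (∀ i j → Bit (P i j))
  × (∀ i i' → (∀ j → P i j ≡ P i' j) → i ≡ i')
  × (∀ (v : Fin n → ℤ) → (∀ j → Bit (v j)) → ∃ λ i → ∀ j → P i j ≡ v j)

DifferInOne : ∀ {n} → (Fin n → ℤ) → (Fin n → ℤ) → Set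
DifferInOne {n} u v = Σ (Fin n) λ j → (u j ≢ v j) × (∀ j' → u j' ≢ v j' → j' ≡ j)

InC : (n : ℕ) → Mat (2 ^ n) n → Set
InC n P = IsPreference n P ×
  (∀ (i : ℕ) (p : suc i < 2 ^ n) →
     DifferInOne (P (fromℕ< (<-trans (n<1+n i) p))) (P (fromℕ< p)))

Sign : ℤ → Set
Sign x = (x ≡ + 0) ⊎ (x ≡ + 1) ⊎ (x ≡ -[1+ 0 ])

InH : (n : ℕ) → Mat n n → Set
InH n M =
  (∀ i j → Sign (M i j))
  × (∀ i → Σ (Fin n) λ j → (M i j ≢ + 0) × (∀ j' → M i j' ≢ + 0 → j' ≡ j))
  × (∀ j → Σ (Fin n) λ i → (M i j ≢ + 0) × (∀ i' → M i' j ≢ + 0 → i' ≡ i))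

φ : ∀ {n} → Mat (2 ^ n) n → Mat n n → Mat (2 ^ n) n
φ P M = bar (bar P *ₘ M)

-- Barring is an involution, so φ P M = bar (bar P · M) is bar P · M conjugated by
-- bar; the action laws then reduce to associativity of the matrix product and P · I = P.
-- For well-definedness, a signed permutation matrix M has in column j a single nonzero entry
-- s = ±1, in row σ j, so row v of P is sent to the vector whose j-th coordinate is
-- bar (bar (v (σ j)) · s): the coordinates are permuted by σ and some of them have 0 and 1
-- swapped. Such a symmetry of the cube {0,1}ⁿ permutes its points and preserves Hamming
-- distance, hence maps Gray codes to Gray codes.
module Submission where

open import Defs
open import Data.Nat using (ℕ; zero; suc; _≤_; _^_)
open import Data.Integer using (ℤ; +_; -[1+_]; _+_; _*_)
open import Data.Integer.Properties using (+-*-semiring; +-identityʳ; *-zeroʳ; *-identityʳ; *-assoc)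
open import Algebra.Properties.Semiring.Sum +-*-semiring
  using (sum; sum-cong-≗; sum-remove; sum-replicate-zero; ∑-comm; *-distribˡ-sum; *-distribʳ-sum)
open import Data.Fin using (Fin; zero; suc; punchIn; _≟_)
open import Data.Fin.Properties using (punchInᵢ≢i)
open import Data.Fin.Permutation using (Permutation′; permutation; _⟨$⟩ʳ_; _⟨$⟩ˡ_; inverseˡ; inverseʳ)
open import Data.Product using (∃; _×_; _,_; proj₁; proj₂)
open import Data.Sum using (_⊎_; inj₁; inj₂)
open import Data.Empty using (⊥-elim)
open import Relation.Nullary using (yes; no)
open import Relation.Binary.PropositionalEquality
  using (_≡_; _≢_; _≗_; refl; sym; trans; cong; subst; module ≡-Reasoning)

open ≡-Reasoning

sumFin≡sum : ∀ n (f : Fin n → ℤ) → sumFin n f ≡ sum f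
sumFin≡sum zero f = refl
sumFin≡sum (suc n) f = cong (_+_ (f zero)) (sumFin≡sum n (λ j → f (suc j)))

sumFin-cong : ∀ n {f g : Fin n → ℤ} → f ≗ g → sumFin n f ≡ sumFin n g
sumFin-cong n {f} {g} f≗g = begin
  sumFin n f ≡⟨ sumFin≡sum n f ⟩
  sum f      ≡⟨ sum-cong-≗ f≗g ⟩
  sum g      ≡⟨ sumFin≡sum n g ⟨
  sumFin n g ∎

sumFin-supported : ∀ n (f : Fin n → ℤ) (k : Fin n) → (∀ j → j ≢ k → f j ≡ + 0) →
                   sumFin n f ≡ f k
sumFin-supported (suc n) f k vanish = begin
  sumFin (suc n) f                  ≡⟨ sumFin≡sum (suc n) f ⟩
  sum f                             ≡⟨ sum-remove {i = k} f ⟩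
  f k + sum (λ j → f (punchIn k j)) ≡⟨ cong (_+_ (f k)) (sum-cong-≗ (λ j → vanish _ (punchInᵢ≢i k j))) ⟩
  f k + sum {n} (λ _ → + 0)         ≡⟨ cong (_+_ (f k)) (sum-replicate-zero n) ⟩
  f k + + 0                         ≡⟨ +-identityʳ (f k) ⟩
  f k                               ∎

*ₘ-congˡ : ∀ {m k l} {A A′ : Mat m k} (B : Mat k l) → A ≈ₘ A′ → (A *ₘ B) ≈ₘ (A′ *ₘ B)
*ₘ-congˡ {k = k} B A≈A′ i l = sumFin-cong k (λ j → cong (_* B j l) (A≈A′ i j))

*ₘ-assoc : ∀ {m k n l} (A : Mat m k) (B : Mat k n) (C : Mat n l) →
           ((A *ₘ B) *ₘ C) ≈ₘ (A *ₘ (B *ₘ C))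
*ₘ-assoc {k = k} {n = n} A B C i q = begin
  sumFin n (λ j → (A *ₘ B) i j * C j q)
    ≡⟨ sumFin≡sum n _ ⟩
  sum (λ j → (A *ₘ B) i j * C j q)
    ≡⟨ sum-cong-≗ expandˡ ⟩
  sum (λ j → sum (λ t → A i t * B t j * C j q))
    ≡⟨ ∑-comm (λ j t → A i t * B t j * C j q) ⟩
  sum (λ t → sum (λ j → A i t * B t j * C j q))
    ≡⟨ sum-cong-≗ expandʳ ⟨
  sum (λ t → A i t * (B *ₘ C) t q)
    ≡⟨ sumFin≡sum k _ ⟨
  sumFin k (λ t → A i t * (B *ₘ C) t q) ∎
  where
  expandˡ : ∀ j → (A *ₘ B) i j * C j q ≡ sum (λ t → A i t * B t j * C j q)
  expandˡ j = trans (cong (_* C j q) (sumFin≡sum k _)) (*-distribʳ-sum (C j q) (λ t → A i t * B t j))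

  expandʳ : ∀ t → A i t * (B *ₘ C) t q ≡ sum (λ j → A i t * B t j * C j q)
  expandʳ t = begin
    A i t * (B *ₘ C) t q                  ≡⟨ cong (A i t *_) (sumFin≡sum n _) ⟩
    A i t * sum (λ j → B t j * C j q)     ≡⟨ *-distribˡ-sum (A i t) (λ j → B t j * C j q) ⟩
    sum (λ j → A i t * (B t j * C j q))   ≡⟨ sum-cong-≗ (λ j → *-assoc (A i t) (B t j) (C j q)) ⟨
    sum (λ j → A i t * B t j * C j q)     ∎

*ₘ-identityʳ : ∀ {m k} (A : Mat m k) → (A *ₘ idM k) ≈ₘ A
*ₘ-identityʳ {k = k} A i l = begin
  sumFin k (λ j → A i j * idM k j l) ≡⟨ sumFin-supported k _ l off-diagonal ⟩
  A i l * idM k l l                  ≡⟨ cong (A i l *_) diagonal ⟩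
  A i l * + 1                        ≡⟨ *-identityʳ (A i l) ⟩
  A i l                              ∎
  where
  off-diagonal : ∀ j → j ≢ l → A i j * idM k j l ≡ + 0
  off-diagonal j j≢l with j ≟ l
  ... | yes j≡l = ⊥-elim (j≢l j≡l)
  ... | no _    = *-zeroʳ (A i j)

  diagonal : idM k l l ≡ + 1
  diagonal with l ≟ l
  ... | yes _  = refl
  ... | no l≢l = ⊥-elim (l≢l refl)

barℤ-involutive : ∀ x → barℤ (barℤ x) ≡ x
barℤ-involutive (+ zero)     = refl
barℤ-involutive (+ suc n)    = refl
barℤ-involutive -[1+ zero ]  = refl
barℤ-involutive -[1+ suc n ] = refl

φ-identity : ∀ {n} (P : Mat (2 ^ n) n) → φ P (idM n) ≈ₘ P
φ-identity P i j = trans (cong barℤ (*ₘ-identityʳ (bar P) i j)) (barℤ-involutive (P i j))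

φ-compose : ∀ {n} (P : Mat (2 ^ n) n) (M N : Mat n n) → φ (φ P M) N ≈ₘ φ P (M *ₘ N)
φ-compose P M N i j = cong barℤ (begin
  (bar (bar (bar P *ₘ M)) *ₘ N) i j ≡⟨ *ₘ-congˡ N (λ i′ j′ → barℤ-involutive ((bar P *ₘ M) i′ j′)) i j ⟩
  ((bar P *ₘ M) *ₘ N) i j           ≡⟨ *ₘ-assoc (bar P) M N i j ⟩
  (bar P *ₘ (M *ₘ N)) i j           ∎)

BitVector : ∀ {n} → (Fin n → ℤ) → Set
BitVector v = ∀ j → Bit (v j)

record IsCubeSymmetry {n} (g : (Fin n → ℤ) → Fin n → ℤ) : Set where
  field
    π               : Permutation′ n
    flip            : Fin n → ℤ → ℤ
    flip-bit        : ∀ j {b} → Bit b → Bit (flip j b)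
    flip-involutive : ∀ j {b} → Bit b → flip j (flip j b) ≡ b
    g-formula       : ∀ v j → g v j ≡ flip j (v (π ⟨$⟩ʳ j))

module CubeSymmetry {n} {g : (Fin n → ℤ) → Fin n → ℤ} (isSym : IsCubeSymmetry g) where
  open IsCubeSymmetry isSym

  flip-injective : ∀ j {a b} → Bit a → Bit b → flip j a ≡ flip j b → a ≡ b
  flip-injective j {a} {b} bit-a bit-b fa≡fb = begin
    a                 ≡⟨ flip-involutive j bit-a ⟨
    flip j (flip j a) ≡⟨ cong (flip j) fa≡fb ⟩
    flip j (flip j b) ≡⟨ flip-involutive j bit-b ⟩
    b                 ∎

  g-bits : ∀ {v} → BitVector v → BitVector (g v)
  g-bits {v} bits j = subst Bit (sym (g-formula v j)) (flip-bit j (bits (π ⟨$⟩ʳ j)))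

  g-congAt : ∀ {v w} j → v (π ⟨$⟩ʳ j) ≡ w (π ⟨$⟩ʳ j) → g v j ≡ g w j
  g-congAt {v} {w} j e = trans (g-formula v j) (trans (cong (flip j) e) (sym (g-formula w j)))

  g-injectiveAt : ∀ {v w} → BitVector v → BitVector w →
                  ∀ k → g v (π ⟨$⟩ˡ k) ≡ g w (π ⟨$⟩ˡ k) → v k ≡ w k
  g-injectiveAt {v} {w} bits-v bits-w k e =
    subst (λ k → v k ≡ w k) (inverseʳ π)
      (flip-injective j (bits-v _) (bits-w _) (trans (sym (g-formula v j)) (trans e (g-formula w j))))
    where j = π ⟨$⟩ˡ k

  g-surjective : ∀ {w} → BitVector w → ∃ λ v → BitVector v × g v ≗ w
  g-surjective {w} bits-w = v , (λ k → flip-bit _ (bits-w _)) , g-v≗w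
    where
    v : Fin n → ℤ
    v k = flip (π ⟨$⟩ˡ k) (w (π ⟨$⟩ˡ k))

    g-v≗w : g v ≗ w
    g-v≗w j = begin
      g v j
        ≡⟨ g-formula v j ⟩
      flip j (flip (π ⟨$⟩ˡ (π ⟨$⟩ʳ j)) (w (π ⟨$⟩ˡ (π ⟨$⟩ʳ j))))
        ≡⟨ cong (λ i → flip j (flip i (w i))) (inverseˡ π) ⟩
      flip j (flip j (w j))
        ≡⟨ flip-involutive j (bits-w j) ⟩
      w j ∎

  g-differInOne : ∀ {v w} → BitVector v → BitVector w → DifferInOne v w → DifferInOne (g v) (g w)
  g-differInOne {v} {w} bits-v bits-w (k , vk≢wk , only-k) = π ⟨$⟩ˡ k , differs , only
    where
    differs : g v (π ⟨$⟩ˡ k) ≢ g w (π ⟨$⟩ˡ k)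
    differs e = vk≢wk (g-injectiveAt bits-v bits-w k e)

    only : ∀ j → g v j ≢ g w j → j ≡ π ⟨$⟩ˡ k
    only j gvj≢gwj = trans (sym (inverseˡ π)) (cong (π ⟨$⟩ˡ_) (only-k _ (λ e → gvj≢gwj (g-congAt j e))))

  preserves-InC : ∀ {P} → InC n P → InC n (λ i → g (P i))
  preserves-InC {P} ((bits , injective , surjective) , adjacent) =
    ((λ i → g-bits (bits i)) , injective′ , surjective′) ,
    λ i p → g-differInOne (bits _) (bits _) (adjacent i p)
    where
    injective′ : ∀ i i′ → g (P i) ≗ g (P i′) → i ≡ i′
    injective′ i i′ e = injective i i′ (λ k → g-injectiveAt (bits i) (bits i′) k (e _))

    surjective′ : ∀ w → BitVector w → ∃ λ i → g (P i) ≗ w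
    surjective′ w bits-w with g-surjective bits-w
    ... | v , bits-v , g-v≗w with surjective v bits-v
    ... | i , Pi≗v = i , λ j → trans (g-congAt j (Pi≗v _)) (g-v≗w j)

IsUnit : ℤ → Set
IsUnit s = (s ≡ + 1) ⊎ (s ≡ -[1+ 0 ])

IsUnit⇒≢0 : ∀ {s} → IsUnit s → s ≢ + 0
IsUnit⇒≢0 (inj₁ refl) ()
IsUnit⇒≢0 (inj₂ refl) ()

-- For s = 1 this is the identity on {0,1}, for s = -1 it swaps 0 and 1.
barScale : ℤ → ℤ → ℤ
barScale s b = barℤ (barℤ b * s)

barScale-bit : ∀ {s b} → IsUnit s → Bit b → Bit (barScale s b)
barScale-bit (inj₁ refl) (inj₁ refl) = inj₁ refl
barScale-bit (inj₁ refl) (inj₂ refl) = inj₂ refl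
barScale-bit (inj₂ refl) (inj₁ refl) = inj₂ refl
barScale-bit (inj₂ refl) (inj₂ refl) = inj₁ refl

barScale-involutive : ∀ {s b} → IsUnit s → Bit b → barScale s (barScale s b) ≡ b
barScale-involutive (inj₁ refl) (inj₁ refl) = refl
barScale-involutive (inj₁ refl) (inj₂ refl) = refl
barScale-involutive (inj₂ refl) (inj₁ refl) = refl
barScale-involutive (inj₂ refl) (inj₂ refl) = refl

-- Chosen so that φ P M i is definitionally rowAct M (P i).
rowAct : ∀ {n} → Mat n n → (Fin n → ℤ) → Fin n → ℤ
rowAct {n} M v j = barℤ (sumFin n (λ t → barℤ (v t) * M t j))

module SignedPermutation {n} {M : Mat n n} (hM : InH n M) where
  -- Sign x unfolds to x ≡ + 0 ⊎ IsUnit x.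
  entry : ∀ i j → (M i j ≡ + 0) ⊎ IsUnit (M i j)
  entry = proj₁ hM

  pivotColumn : Fin n → Fin n
  pivotColumn i = proj₁ (proj₁ (proj₂ hM) i)

  pivotColumn-nonzero : ∀ i → M i (pivotColumn i) ≢ + 0
  pivotColumn-nonzero i = proj₁ (proj₂ (proj₁ (proj₂ hM) i))

  pivotColumn-unique : ∀ i j → M i j ≢ + 0 → j ≡ pivotColumn i
  pivotColumn-unique i = proj₂ (proj₂ (proj₁ (proj₂ hM) i))

  pivotRow : Fin n → Fin n
  pivotRow j = proj₁ (proj₂ (proj₂ hM) j)

  pivotRow-nonzero : ∀ j → M (pivotRow j) j ≢ + 0
  pivotRow-nonzero j = proj₁ (proj₂ (proj₂ (proj₂ hM) j))

  pivotRow-unique : ∀ i j → M i j ≢ + 0 → i ≡ pivotRow j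
  pivotRow-unique i j = proj₂ (proj₂ (proj₂ (proj₂ hM) j)) i

  pivotRow∘pivotColumn : ∀ i → pivotRow (pivotColumn i) ≡ i
  pivotRow∘pivotColumn i = sym (pivotRow-unique i _ (pivotColumn-nonzero i))

  pivotColumn∘pivotRow : ∀ j → pivotColumn (pivotRow j) ≡ j
  pivotColumn∘pivotRow j = sym (pivotColumn-unique _ j (pivotRow-nonzero j))

  off-pivot : ∀ i j → i ≢ pivotRow j → M i j ≡ + 0
  off-pivot i j i≢pivot with entry i j
  ... | inj₁ Mij≡0 = Mij≡0
  ... | inj₂ unit  = ⊥-elim (i≢pivot (pivotRow-unique i j (IsUnit⇒≢0 unit)))

  pivot-unit : ∀ j → IsUnit (M (pivotRow j) j)
  pivot-unit j with entry (pivotRow j) j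
  ... | inj₁ pivot≡0 = ⊥-elim (pivotRow-nonzero j pivot≡0)
  ... | inj₂ unit    = unit

  rowAct-isCubeSymmetry : IsCubeSymmetry (rowAct M)
  rowAct-isCubeSymmetry = record
    { π               = permutation pivotRow pivotColumn pivotRow∘pivotColumn pivotColumn∘pivotRow
    ; flip            = λ j → barScale (M (pivotRow j) j)
    ; flip-bit        = λ j → barScale-bit (pivot-unit j)
    ; flip-involutive = λ j → barScale-involutive (pivot-unit j)
    ; g-formula       = λ v j → cong barℤ (sumFin-supported n _ (pivotRow j)
                          (λ t t≢pivot → trans (cong (barℤ (v t) *_) (off-pivot t j t≢pivot))
                                               (*-zeroʳ (barℤ (v t)))))
    }

φ-preserves-InC : ∀ {n} (P : Mat (2 ^ n) n) (M : Mat n n) → InC n P → InH n M → InC n (φ P M)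
φ-preserves-InC P M hP hM =
  CubeSymmetry.preserves-InC (SignedPermutation.rowAct-isCubeSymmetry hM) hP

lemma1 : (n : ℕ) → 1 ≤ n →
    (∀ (P : Mat (2 ^ n) n) (M : Mat n n) → InC n P → InH n M → InC n (φ P M))
    × (∀ (P : Mat (2 ^ n) n) → InC n P → φ P (idM n) ≈ₘ P)
    × (∀ (P : Mat (2 ^ n) n) (M N : Mat n n) → InC n P → InH n M → InH n N →
         φ (φ P M) N ≈ₘ φ P (M *ₘ N))
lemma1 n _ =
  φ-preserves-InC ,
  (λ P _ → φ-identity P) ,
  (λ P M N _ _ _ → φ-compose P M N)
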